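{- Let $d\ge 0$ be an integer and let $H$ be a graph of degeneracy at most $d$. Then $H$ is a $4d$-star or $H$ admits a good $(4d,2d)$-partition.
   Context: Graphs are finite, simple and undirected. A graph has degeneracy at most $d$ if every induced subgraph has a vertex of degree at most $d$ in it. A graph $H$ is a $k$-star if there is a partition $\{A,B\}$ of $V(H)$ with $|A|\le k$ and $B$ an independent set (equivalently, $H$ has a vertex cover of size at most $k$). For an edge $e=ab$ of $H$, $N_H(e)=(N_H(a)\cup N_H(b))\setminus\{a,b\}$. $H$ admits a good $(\ell,k)$-partition if there exist $k$ edges $e_1,\dots,e_k$ of $H$ and a partition $\{A_0,\dots,A_k\}$ of $V(H)\setminus(e_1\cup\dots\cup e_k)$ such that $N_H(e_i)\cap A_i=\emptyset$ for all $i\in[k]$ and $|A_0|\le\ell$. -}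

module Defs where

open import Data.Nat using (ℕ; zero; suc; _≤_; _*_)
open import Data.Bool using (Bool; true; false; not; _∧_; _∨_)
open import Data.Fin using (Fin) renaming (zero to fzero; suc to fsuc)
open import Data.Fin.Properties using (_≟_)
open import Data.Fin.Subset using (Subset; _∈_; _∉_; _∩_; ∣_∣; Nonempty)
open import Data.Vec using (tabulate)
open import Data.List using (allFin)
open import Data.Bool.ListAction using (any)
open import Data.Product using (Σ; ∃; _×_; _,_; proj₁; proj₂)
open import Data.Sum using (_⊎_)
open import Relation.Nullary using (¬_)
open import Relation.Nullary.Decidable using (⌊_⌋)
open import Relation.Binary.PropositionalEquality using (_≡_; _≢_)

record Graph : Set where
  field
    n      : ℕ
    adj    : Fin n → Fin n → Bool
    sym    : ∀ u v → adj u v ≡ adj v u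
    irrefl : ∀ v → adj v v ≡ false
open Graph public

nbhd : (H : Graph) → Fin (n H) → Subset (n H)
nbhd H v = tabulate (λ u → adj H v u)

degIn : (H : Graph) → Subset (n H) → Fin (n H) → ℕ
degIn H S v = ∣ nbhd H v ∩ S ∣

DegeneracyAtMost : ℕ → Graph → Set
DegeneracyAtMost d H =
  (S : Subset (n H)) → Nonempty S →
  ∃ λ v → v ∈ S × degIn H S v ≤ d

IsStar : ℕ → Graph → Set
IsStar k H =
  Σ (Subset (n H)) λ A →
    ∣ A ∣ ≤ k ×
    (∀ u v → u ∉ A → v ∉ A → adj H u v ≡ false)

record EdgeFamily (H : Graph) (k : ℕ) : Set where
  field
    fst      : Fin k → Fin (n H)
    snd      : Fin k → Fin (n H)
    isEdge   : ∀ i → adj H (fst i) (snd i) ≡ true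
    distinct : ∀ i j → i ≢ j →
               ¬ (fst i ≡ fst j × snd i ≡ snd j) ×
               ¬ (fst i ≡ snd j × snd i ≡ fst j)
open EdgeFamily public

covered : {H : Graph} {k : ℕ} → EdgeFamily H k → Fin (n H) → Bool
covered {k = k} E v =
  any (λ i → ⌊ v ≟ fst E i ⌋ ∨ ⌊ v ≟ snd E i ⌋) (allFin k)

isZero : {m : ℕ} → Fin (suc m) → Bool
isZero fzero    = true
isZero (fsuc _) = false

-- H admits a good (ℓ,k)-partition: k edges e_1..e_k and a partition
-- {A_0,…,A_k} of V(H) \ (e_1 ∪ … ∪ e_k), given by an assignment c of each
-- uncovered vertex v to the part A_(c v) (parts may be empty), such that
-- N_H(e_i) ∩ A_i = ∅ for every i and |A_0| ≤ ℓ.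
GoodPartition : ℕ → ℕ → Graph → Set
GoodPartition ℓ k H =
  Σ (EdgeFamily H k) λ E →
  Σ (Fin (n H) → Fin (suc k)) λ c →
    (∀ (i : Fin k) (v : Fin (n H)) → covered E v ≡ false → c v ≡ fsuc i →
       adj H v (fst E i) ≡ false × adj H v (snd E i) ≡ false)
    × ∣ tabulate (λ v → not (covered E v) ∧ isZero (c v)) ∣ ≤ ℓ

{-# OPTIONS --safe #-}
module Submission where

-- Greedily collect pairwise disjoint edges.  If this stops after m < 2d edges, the 2m
-- covered vertices meet every edge, so H is a 4d-star.  Otherwise fix 2d disjoint
-- edges e_i, put every uncovered vertex avoiding some e_i into such an A_i, and the
-- rest into A_0.  Each vertex of A_0 has a neighbour on every e_i, so at least 2d of
-- the 4d covered vertices are its neighbours.  Peeling off vertices of degree at most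
-- d shows that a graph of degeneracy at most d has at most d|S| edges inside any S;
-- with S = A_0 ∪ V(e_1 ∪ … ∪ e_2d) this gives 2d|A_0| ≤ d(|A_0| + 4d), i.e.
-- |A_0| ≤ 4d.  For d = 0 the graph is edgeless and the empty set is a vertex cover.

open import Defs hiding (sym)
open import Data.Bool using (Bool; true; false; not; _∧_; _∨_; T)
open import Data.Bool.Properties
  using (∧-comm; ∧-identityʳ; ∧-conicalʳ; ∨-zeroʳ; ¬-not; T-≡; T-∨) renaming (_≟_ to _≟ᵇ_)
open import Data.Fin using (Fin) renaming (zero to fzero; suc to fsuc)
open import Data.Fin.Properties using (_≟_; any?) renaming (suc-injective to fsuc-injective)
open import Data.Fin.Subset using (Subset; ∣_∣; _∩_; _∈_; _∉_) renaming (⊥ to ∅)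
open import Data.Fin.Subset.Properties using (∣⊥∣≡0)
open import Data.List using (allFin)
open import Data.List.Membership.Propositional using (lose)
open import Data.List.Membership.Propositional.Properties using (∈-allFin)
open import Data.List.Relation.Unary.Any using (satisfied)
open import Data.List.Relation.Unary.Any.Properties using (any⁺; any⁻)
open import Data.Nat using (ℕ; zero; suc; _+_; _*_; _≤_; z≤n; s≤s; NonZero)
open import Data.Nat.Properties
  using (≤-refl; ≤-trans; ≤-reflexive; +-mono-≤; +-monoʳ-≤; +-comm; +-identityʳ; +-cancelˡ-≤;
         *-comm; *-assoc; *-identityˡ; *-identityʳ; *-zeroʳ; *-suc; *-distribˡ-+; *-distribʳ-+;
         *-monoʳ-≤; *-cancelˡ-≤; m≤m+n; m≤n+m; n≤1+n; suc-injective; +-*-semiring; module ≤-Reasoning)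
open import Algebra.Properties.Semiring.Sum +-*-semiring
  using (sum; sum-syntax; sum-cong-≗; sum-replicate-zero; ∑-distrib-+; ∑-comm; *-distribˡ-sum; *-distribʳ-sum)
open import Data.Product using (∃; _×_; _,_)
open import Data.Sum using (_⊎_; inj₁; inj₂; [_,_])
import Data.Sum as Sum
open import Data.Vec using (_∷_; []; tabulate; lookup)
open import Data.Vec.Properties using (lookup∘tabulate; lookup-zipWith; []=⇒lookup; lookup⇒[]=)
import Data.Vec.Functional as Vector
open import Function using (_∘_)
open import Function.Bundles using (Equivalence)
open import Relation.Binary.PropositionalEquality
  using (_≡_; _≢_; refl; sym; trans; cong; cong₂; subst; module ≡-Reasoning)
open import Relation.Nullary using (Dec; yes; no; ¬_; contradiction)
open import Relation.Nullary.Decidable using (⌊_⌋; toWitness; fromWitness; _×-dec_)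

𝟙 : Bool → ℕ
𝟙 true  = 1
𝟙 false = 0

count : ∀ {n} → (Fin n → Bool) → ℕ
count {n} P = ∑[ i < n ] 𝟙 (P i)

𝟙-∧ : ∀ a b → 𝟙 (a ∧ b) ≡ 𝟙 a * 𝟙 b
𝟙-∧ true  b = sym (+-identityʳ (𝟙 b))
𝟙-∧ false b = refl

𝟙-∧-dropˡ : ∀ a b c → 𝟙 ((a ∧ b) ∧ c) ≤ 𝟙 (b ∧ c)
𝟙-∧-dropˡ true  b c = ≤-refl
𝟙-∧-dropˡ false b c = z≤n

𝟙-∧-dropʳ : ∀ a b c → 𝟙 ((a ∧ b) ∧ c) ≤ 𝟙 (a ∧ c)
𝟙-∧-dropʳ true  true  c = ≤-refl
𝟙-∧-dropʳ true  false c = z≤n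
𝟙-∧-dropʳ false b     c = z≤n

𝟙-∧-≤ʳ : ∀ a b → 𝟙 (a ∧ b) ≤ 𝟙 b
𝟙-∧-≤ʳ true  b = ≤-refl
𝟙-∧-≤ʳ false b = z≤n

∑-mono-≤ : ∀ {n} {f g : Fin n → ℕ} → (∀ i → f i ≤ g i) → sum f ≤ sum g
∑-mono-≤ {zero}  f≤g = z≤n
∑-mono-≤ {suc n} f≤g = +-mono-≤ (f≤g fzero) (∑-mono-≤ (f≤g ∘ fsuc))

∑-const : ∀ n c → ∑[ i < n ] c ≡ n * c
∑-const zero    c = refl
∑-const (suc n) c = cong (c +_) (∑-const n c)

∑-zero : ∀ {n} (f : Fin n → ℕ) → (∀ i → f i ≡ 0) → sum f ≡ 0
∑-zero {n} f f≡0 = trans (sum-cong-≗ f≡0) (sum-replicate-zero n)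

∑-supported : ∀ {n} (f : Fin n → ℕ) v → (∀ u → u ≢ v → f u ≡ 0) → sum f ≡ f v
∑-supported {suc n} f fzero f≡0 =
  trans (cong (f fzero +_) (∑-zero (f ∘ fsuc) (λ u → f≡0 (fsuc u) λ ()))) (+-identityʳ (f fzero))
∑-supported {suc n} f (fsuc v) f≡0 =
  cong₂ _+_ (f≡0 fzero λ ()) (∑-supported (f ∘ fsuc) v (λ u u≢v → f≡0 (fsuc u) (u≢v ∘ fsuc-injective)))

∑-δ : ∀ {n} (f : Fin n → ℕ) v → ∑[ u < n ] (𝟙 ⌊ u ≟ v ⌋ * f u) ≡ f v
∑-δ f v = trans (∑-supported _ v off) (on v)
  where
  off : ∀ u → u ≢ v → 𝟙 ⌊ u ≟ v ⌋ * f u ≡ 0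
  off u u≢v with u ≟ v
  ... | yes u≡v = contradiction u≡v u≢v
  ... | no _    = refl
  on : ∀ v → 𝟙 ⌊ v ≟ v ⌋ * f v ≡ f v
  on v with v ≟ v
  ... | yes _   = +-identityʳ (f v)
  ... | no v≢v  = contradiction refl v≢v

∣p∣≡count : ∀ {n} (p : Subset n) → ∣ p ∣ ≡ count (lookup p)
∣p∣≡count []          = refl
∣p∣≡count (true  ∷ p) = cong suc (∣p∣≡count p)
∣p∣≡count (false ∷ p) = ∣p∣≡count p

∈-tabulate : ∀ {n} {P : Fin n → Bool} {u} → P u ≡ true → u ∈ tabulate P
∈-tabulate {P = P} {u} Pu = lookup⇒[]= u (tabulate P) (trans (lookup∘tabulate P u) Pu)

∈-tabulate⁻ : ∀ {n} {P : Fin n → Bool} {u} → u ∈ tabulate P → P u ≡ true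
∈-tabulate⁻ {P = P} {u} u∈P = trans (sym (lookup∘tabulate P u)) ([]=⇒lookup u∈P)

∉-tabulate : ∀ {n} {P : Fin n → Bool} {u} → u ∉ tabulate P → P u ≡ false
∉-tabulate u∉P = ¬-not (u∉P ∘ ∈-tabulate)

∣tabulate∣≡count : ∀ {n} (P : Fin n → Bool) → ∣ tabulate P ∣ ≡ count P
∣tabulate∣≡count P = trans (∣p∣≡count (tabulate P)) (sum-cong-≗ (cong 𝟙 ∘ lookup∘tabulate P))

count-⁅⁆ : ∀ {n} (v : Fin n) → count (λ u → ⌊ u ≟ v ⌋) ≡ 1
count-⁅⁆ v = trans (sum-cong-≗ (λ u → sym (*-identityʳ (𝟙 ⌊ u ≟ v ⌋)))) (∑-δ (λ _ → 1) v)

_-_ : ∀ {n} → (Fin n → Bool) → Fin n → Fin n → Bool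
(S - v) u = not ⌊ u ≟ v ⌋ ∧ S u

count-remove : ∀ {n} (S : Fin n → Bool) {v} → S v ≡ true → count S ≡ suc (count (S - v))
count-remove {n} S {v} Sv = begin
  count S                                   ≡⟨ sum-cong-≗ split ⟩
  ∑[ u < n ] (𝟙 ((S - v) u) + 𝟙 ⌊ u ≟ v ⌋)  ≡⟨ ∑-distrib-+ (𝟙 ∘ (S - v)) (λ u → 𝟙 ⌊ u ≟ v ⌋) ⟩
  count (S - v) + count (λ u → ⌊ u ≟ v ⌋)   ≡⟨ cong (count (S - v) +_) (count-⁅⁆ v) ⟩
  count (S - v) + 1                         ≡⟨ +-comm _ 1 ⟩
  suc (count (S - v))                       ∎
  where
  open ≡-Reasoning
  split : ∀ u → 𝟙 (S u) ≡ 𝟙 ((S - v) u) + 𝟙 ⌊ u ≟ v ⌋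
  split u with u ≟ v
  ... | yes refl = cong 𝟙 Sv
  ... | no _     = sym (+-identityʳ _)

count-∨ : ∀ {n} {B M : Fin n → Bool} → (∀ v → B v ≡ true → M v ≡ false) →
          count (λ u → B u ∨ M u) ≡ count B + count M
count-∨ {B = B} {M} disjoint = trans (sum-cong-≗ split) (∑-distrib-+ (𝟙 ∘ B) (𝟙 ∘ M))
  where
  split : ∀ u → 𝟙 (B u ∨ M u) ≡ 𝟙 (B u) + 𝟙 (M u)
  split u with B u in Bu
  ... | true  = cong (1 +_) (sym (cong 𝟙 (disjoint u Bu)))
  ... | false = refl

∑∑-δ : ∀ {n} (f g : Fin n → ℕ) v →
        ∑[ u < n ] ∑[ w < n ] (𝟙 ⌊ u ≟ v ⌋ * f w + 𝟙 ⌊ w ≟ v ⌋ * g u) ≡ sum f + sum g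
∑∑-δ {n} f g v = begin
  ∑[ u < n ] ∑[ w < n ] (𝟙 ⌊ u ≟ v ⌋ * f w + 𝟙 ⌊ w ≟ v ⌋ * g u)
    ≡⟨ sum-cong-≗ (λ u → ∑-distrib-+ (λ w → 𝟙 ⌊ u ≟ v ⌋ * f w) (λ w → 𝟙 ⌊ w ≟ v ⌋ * g u)) ⟩
  ∑[ u < n ] (∑[ w < n ] (𝟙 ⌊ u ≟ v ⌋ * f w) + ∑[ w < n ] (𝟙 ⌊ w ≟ v ⌋ * g u))
    ≡⟨ sum-cong-≗ (λ u → cong₂ _+_ (sym (*-distribˡ-sum (𝟙 ⌊ u ≟ v ⌋) f)) (∑-δ (λ _ → g u) v)) ⟩
  ∑[ u < n ] (𝟙 ⌊ u ≟ v ⌋ * sum f + g u)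
    ≡⟨ ∑-distrib-+ (λ u → 𝟙 ⌊ u ≟ v ⌋ * sum f) g ⟩
  ∑[ u < n ] (𝟙 ⌊ u ≟ v ⌋ * sum f) + sum g
    ≡⟨ cong (_+ sum g) (∑-δ (λ _ → sum f) v) ⟩
  sum f + sum g
    ∎
  where open ≡-Reasoning

2dx≤d[x+c]⇒x≤c : ∀ d {x c} .{{_ : NonZero d}} → 2 * d * x ≤ d * (x + c) → x ≤ c
2dx≤d[x+c]⇒x≤c d {x} {c} 2dx≤d[x+c] = *-cancelˡ-≤ d (+-cancelˡ-≤ (d * x) (d * x) (d * c) (begin
  d * x + d * x   ≡⟨ cong (d * x +_) (+-identityʳ (d * x)) ⟨
  2 * (d * x)     ≡⟨ *-assoc 2 d x ⟨
  2 * d * x       ≤⟨ 2dx≤d[x+c] ⟩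
  d * (x + c)     ≡⟨ *-distribˡ-+ d x c ⟩
  d * x + d * c   ∎))
  where open ≤-Reasoning

module _ (H : Graph) where

  private
    N = n H

  PartialOrientation : (Fin N → Fin N → Bool) → Set
  PartialOrientation o = ∀ u w → 𝟙 (o u w) + 𝟙 (o w u) ≤ 𝟙 (adj H u w)

  arcsWithin : (Fin N → Fin N → Bool) → (Fin N → Bool) → ℕ
  arcsWithin o S = ∑[ u < N ] ∑[ w < N ] 𝟙 ((S u ∧ S w) ∧ o u w)

  degreeIn : (Fin N → Bool) → Fin N → ℕ
  degreeIn S v = count (λ w → S w ∧ adj H v w)

  lowDegreeVertex : ∀ {d} → DegeneracyAtMost d H → ∀ {S v} → S v ≡ true →
                    ∃ λ u → S u ≡ true × degreeIn S u ≤ d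
  lowDegreeVertex deg {S} {v} Sv with deg (tabulate S) (v , ∈-tabulate Sv)
  ... | u , u∈S , deg-u = u , ∈-tabulate⁻ u∈S , ≤-trans (≤-reflexive degree-eq) deg-u
    where
    degree-eq : degreeIn S u ≡ degIn H (tabulate S) u
    degree-eq = sym (trans (∣p∣≡count (nbhd H u ∩ tabulate S)) (sum-cong-≗ λ w → cong 𝟙 (begin
      lookup (nbhd H u ∩ tabulate S) w            ≡⟨ lookup-zipWith _∧_ w (nbhd H u) (tabulate S) ⟩
      lookup (nbhd H u) w ∧ lookup (tabulate S) w ≡⟨ cong₂ _∧_ (lookup∘tabulate (adj H u) w) (lookup∘tabulate S w) ⟩
      adj H u w ∧ S w                             ≡⟨ ∧-comm (adj H u w) (S w) ⟩
      S w ∧ adj H u w                             ∎)))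
      where open ≡-Reasoning

  arc-remove : ∀ (o : Fin N → Fin N → Bool) (S : Fin N → Bool) (v u w : Fin N) →
               𝟙 ((S u ∧ S w) ∧ o u w) ≤
               𝟙 (((S - v) u ∧ (S - v) w) ∧ o u w) +
               (𝟙 ⌊ u ≟ v ⌋ * 𝟙 (S w ∧ o v w) + 𝟙 ⌊ w ≟ v ⌋ * 𝟙 (S u ∧ o u v))
  arc-remove o S v u w with u ≟ v | w ≟ v
  ... | yes refl | w≟u = begin
    𝟙 ((S u ∧ S w) ∧ o u w)   ≤⟨ 𝟙-∧-dropˡ (S u) (S w) (o u w) ⟩
    𝟙 (S w ∧ o u w)           ≡⟨ *-identityˡ _ ⟨
    1 * 𝟙 (S w ∧ o u w)       ≤⟨ m≤m+n _ (𝟙 ⌊ w≟u ⌋ * 𝟙 (S u ∧ o u u)) ⟩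
    1 * 𝟙 (S w ∧ o u w) + 𝟙 ⌊ w≟u ⌋ * 𝟙 (S u ∧ o u u) ∎
    where open ≤-Reasoning
  ... | no _ | yes refl = begin
    𝟙 ((S u ∧ S w) ∧ o u w)   ≤⟨ 𝟙-∧-dropʳ (S u) (S w) (o u w) ⟩
    𝟙 (S u ∧ o u w)           ≡⟨ *-identityˡ _ ⟨
    1 * 𝟙 (S u ∧ o u w)       ≤⟨ m≤n+m _ (𝟙 ((S u ∧ false) ∧ o u w)) ⟩
    𝟙 ((S u ∧ false) ∧ o u w) + (0 + 1 * 𝟙 (S u ∧ o u w)) ∎
    where open ≤-Reasoning
  ... | no _ | no _ = m≤m+n _ 0

  arcsWithin-remove : ∀ {o} → PartialOrientation o → ∀ {S v} → S v ≡ true →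
                      arcsWithin o S ≤ arcsWithin o (S - v) + degreeIn S v
  arcsWithin-remove {o} orient {S} {v} Sv = begin
    arcsWithin o S
      ≤⟨ ∑-mono-≤ (λ u → ∑-mono-≤ (arc-remove o S v u)) ⟩
    ∑[ u < N ] ∑[ w < N ] (kept u w + (δ u * out w + δ w * inc u))
      ≡⟨ trans (sum-cong-≗ (λ u → ∑-distrib-+ (kept u) _)) (∑-distrib-+ (λ u → sum (kept u)) _) ⟩
    arcsWithin o (S - v) + ∑[ u < N ] ∑[ w < N ] (δ u * out w + δ w * inc u)
      ≡⟨ cong (arcsWithin o (S - v) +_) (trans (∑∑-δ out inc v) (sym (∑-distrib-+ out inc))) ⟩
    arcsWithin o (S - v) + ∑[ w < N ] (out w + inc w)
      ≤⟨ +-monoʳ-≤ (arcsWithin o (S - v)) (∑-mono-≤ incident) ⟩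
    arcsWithin o (S - v) + degreeIn S v
      ∎
    where
    open ≤-Reasoning
    δ : Fin N → ℕ
    δ u = 𝟙 ⌊ u ≟ v ⌋
    kept : Fin N → Fin N → ℕ
    kept u w = 𝟙 (((S - v) u ∧ (S - v) w) ∧ o u w)
    out inc : Fin N → ℕ
    out w = 𝟙 (S w ∧ o v w)
    inc u = 𝟙 (S u ∧ o u v)
    incident : ∀ w → out w + inc w ≤ 𝟙 (S w ∧ adj H v w)
    incident w with S w
    ... | true  = orient v w
    ... | false = z≤n

  arcsWithin-≤ : ∀ {d o} → DegeneracyAtMost d H → PartialOrientation o → ∀ S → arcsWithin o S ≤ d * count S
  arcsWithin-≤ {d} {o} deg orient S = peel (count S) S refl
    where
    peel : ∀ c S → count S ≡ c → arcsWithin o S ≤ d * c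
    peel c S eq with any? (λ u → S u ≟ᵇ true)
    peel c S eq | no empty =
      ≤-trans (≤-reflexive (∑-zero _ λ u → ∑-zero _ λ w →
                 cong (λ b → 𝟙 ((b ∧ S w) ∧ o u w)) (¬-not (empty ∘ (u ,_)))))
              z≤n
    peel zero S eq | yes (u , Su) with () ← trans (sym (count-remove S Su)) eq
    peel (suc c) S eq | yes (u , Su) with lowDegreeVertex deg Su
    ... | v , Sv , deg-v = begin
      arcsWithin o S                        ≤⟨ arcsWithin-remove orient Sv ⟩
      arcsWithin o (S - v) + degreeIn S v   ≤⟨ +-mono-≤ (peel c (S - v) smaller) deg-v ⟩
      d * c + d                             ≡⟨ trans (+-comm (d * c) d) (sym (*-suc d c)) ⟩
      d * suc c                             ∎
      where
      open ≤-Reasoning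
      smaller : count (S - v) ≡ c
      smaller = suc-injective (trans (sym (count-remove S Sv)) eq)

  crossing-orientation : ∀ {B M : Fin N → Bool} → (∀ v → B v ≡ true → M v ≡ false) →
                         PartialOrientation (λ u w → B u ∧ (M w ∧ adj H u w))
  crossing-orientation {B} {M} disjoint u w with B u in Bu | B w in Bw
  ... | true  | true  rewrite disjoint u Bu | disjoint w Bw = z≤n
  ... | true  | false = ≤-trans (≤-reflexive (+-identityʳ _)) (𝟙-∧-≤ʳ (M w) (adj H u w))
  ... | false | true  rewrite Graph.sym H w u = 𝟙-∧-≤ʳ (M u) (adj H u w)
  ... | false | false = z≤n

  crossing-≤ : ∀ {d k} → DegeneracyAtMost d H → (B M : Fin N → Bool) →
               (∀ v → B v ≡ true → M v ≡ false) →
               (∀ b → B b ≡ true → k ≤ count (λ w → M w ∧ adj H b w)) →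
               k * count B ≤ d * (count B + count M)
  crossing-≤ {d} {k} deg B M disjoint many = begin
    k * count B                                            ≡⟨ *-distribˡ-sum k (𝟙 ∘ B) ⟩
    ∑[ u < N ] (k * 𝟙 (B u))                               ≤⟨ ∑-mono-≤ fromB ⟩
    ∑[ u < N ] (𝟙 (B u) * count (λ w → M w ∧ adj H u w))   ≡⟨ sum-cong-≗ product ⟩
    ∑[ u < N ] ∑[ w < N ] 𝟙 (o u w)                        ≤⟨ ∑-mono-≤ (λ u → ∑-mono-≤ (within u)) ⟩
    arcsWithin o (λ u → B u ∨ M u)                         ≤⟨ arcsWithin-≤ deg (crossing-orientation disjoint) _ ⟩
    d * count (λ u → B u ∨ M u)                            ≡⟨ cong (d *_) (count-∨ disjoint) ⟩
    d * (count B + count M)                                ∎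
    where
    open ≤-Reasoning
    o : Fin N → Fin N → Bool
    o u w = B u ∧ (M w ∧ adj H u w)
    fromB : ∀ u → k * 𝟙 (B u) ≤ 𝟙 (B u) * count (λ w → M w ∧ adj H u w)
    fromB u with B u in Bu
    ... | true  = ≤-trans (≤-reflexive (*-identityʳ k)) (≤-trans (many u Bu) (≤-reflexive (sym (*-identityˡ _))))
    ... | false = ≤-reflexive (*-zeroʳ k)
    product : ∀ u → 𝟙 (B u) * count (λ w → M w ∧ adj H u w) ≡ ∑[ w < N ] 𝟙 (o u w)
    product u = trans (*-distribˡ-sum (𝟙 (B u)) (λ w → 𝟙 (M w ∧ adj H u w)))
                      (sum-cong-≗ λ w → sym (𝟙-∧ (B u) (M w ∧ adj H u w)))
    within : ∀ u w → 𝟙 (o u w) ≤ 𝟙 (((B u ∨ M u) ∧ (B w ∨ M w)) ∧ o u w)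
    within u w with B u | M w
    ... | true  | true  rewrite ∨-zeroʳ (B w) = ≤-refl
    ... | true  | false = z≤n
    ... | false | _     = z≤n

  -- A single edge ab, taken as B = {a}, M = {b} and k = 1, already violates crossing-≤.
  edgeless : DegeneracyAtMost 0 H → ∀ a b → adj H a b ≡ false
  edgeless deg a b with adj H a b in ab
  ... | false = refl
  ... | true = contradiction one≤zero λ ()
    where
    disjoint : ∀ v → ⌊ v ≟ a ⌋ ≡ true → ⌊ v ≟ b ⌋ ≡ false
    disjoint v va with v ≟ a | v ≟ b
    ... | yes refl | yes refl = contradiction (trans (sym ab) (irrefl H v)) λ ()
    ... | yes refl | no _     = refl
    neighbour : ∀ c → ⌊ c ≟ a ⌋ ≡ true → 1 ≤ count (λ w → ⌊ w ≟ b ⌋ ∧ adj H c w)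
    neighbour c ca with c ≟ a
    ... | yes refl = ≤-reflexive (sym (begin
      count (λ w → ⌊ w ≟ b ⌋ ∧ adj H c w)    ≡⟨ sum-cong-≗ (λ w → 𝟙-∧ ⌊ w ≟ b ⌋ (adj H c w)) ⟩
      ∑[ w < N ] (𝟙 ⌊ w ≟ b ⌋ * 𝟙 (adj H c w)) ≡⟨ ∑-δ (𝟙 ∘ adj H c) b ⟩
      𝟙 (adj H c b)                          ≡⟨ cong 𝟙 ab ⟩
      1                                      ∎))
      where open ≡-Reasoning
    one≤zero : 1 ≤ 0
    one≤zero = ≤-trans (≤-reflexive (sym (trans (*-identityˡ _) (count-⁅⁆ a))))
                       (crossing-≤ deg (λ u → ⌊ u ≟ a ⌋) (λ u → ⌊ u ≟ b ⌋) disjoint neighbour)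

  Endpoint : ∀ {m} → EdgeFamily H m → Fin m → Fin N → Set
  Endpoint E i w = w ≡ fst E i ⊎ w ≡ snd E i

  endpoint⇒covered : ∀ {m} (E : EdgeFamily H m) {i w} → Endpoint E i w → covered E w ≡ true
  endpoint⇒covered E {i} {w} e = Equivalence.to T-≡ (any⁺ _ (lose (∈-allFin i) (Equivalence.from T-∨ t)))
    where
    t : T ⌊ w ≟ fst E i ⌋ ⊎ T ⌊ w ≟ snd E i ⌋
    t = Sum.map (fromWitness {a? = w ≟ fst E i}) (fromWitness {a? = w ≟ snd E i}) e

  covered⇒endpoint : ∀ {m} (E : EdgeFamily H m) {w} → covered E w ≡ true → ∃ λ i → Endpoint E i w
  covered⇒endpoint {m} E {w} c with satisfied (any⁻ _ (allFin m) (Equivalence.from T-≡ c))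
  ... | i , t = i , Sum.map toWitness toWitness (Equivalence.to (T-∨ {⌊ w ≟ fst E i ⌋} {⌊ w ≟ snd E i ⌋}) t)

  record Matching (m : ℕ) : Set where
    field
      left right : Fin m → Fin N
      edge       : ∀ i → adj H (left i) (right i) ≡ true
      disjoint   : ∀ {i j w} → w ≡ left i ⊎ w ≡ right i → w ≡ left j ⊎ w ≡ right j → i ≡ j

    edgeFamily : EdgeFamily H m
    edgeFamily = record
      { fst      = left
      ; snd      = right
      ; isEdge   = edge
      ; distinct = λ i j i≢j → (λ (l , _) → i≢j (disjoint (inj₁ refl) (inj₁ l)))
                              , (λ (l , _) → i≢j (disjoint (inj₁ refl) (inj₂ l)))
      }

    covers : Fin N → Bool
    covers = covered edgeFamily

  open Matching

  endpoints-≢ : ∀ {m} (M : Matching m) i → left M i ≢ right M i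
  endpoints-≢ M i l≡r = contradiction true≡false λ ()
    where
    open ≡-Reasoning
    true≡false : true ≡ false
    true≡false = begin
      true                          ≡⟨ edge M i ⟨
      adj H (left M i) (right M i)  ≡⟨ cong (adj H (left M i)) l≡r ⟨
      adj H (left M i) (left M i)   ≡⟨ irrefl H (left M i) ⟩
      false                         ∎

  𝟙-endpoint : ∀ {m} (M : Matching m) {i w} → Endpoint (edgeFamily M) i w →
               𝟙 ⌊ w ≟ left M i ⌋ + 𝟙 ⌊ w ≟ right M i ⌋ ≡ 1
  𝟙-endpoint M {i} {w} e with w ≟ left M i | w ≟ right M i
  ... | yes refl | yes l≡r = contradiction l≡r (endpoints-≢ M i)
  ... | yes _    | no _    = refl
  ... | no _     | yes _   = refl
  ... | no w≢l   | no w≢r  = contradiction e [ w≢l , w≢r ]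

  𝟙-non-endpoint : ∀ {m} (M : Matching m) {i w} → ¬ Endpoint (edgeFamily M) i w →
                   𝟙 ⌊ w ≟ left M i ⌋ + 𝟙 ⌊ w ≟ right M i ⌋ ≡ 0
  𝟙-non-endpoint M {i} {w} ¬e with w ≟ left M i | w ≟ right M i
  ... | yes w≡l | _       = contradiction (inj₁ w≡l) ¬e
  ... | no _    | yes w≡r = contradiction (inj₂ w≡r) ¬e
  ... | no _    | no _    = refl

  𝟙-covers : ∀ {m} (M : Matching m) w →
             𝟙 (covers M w) ≡ ∑[ i < m ] (𝟙 ⌊ w ≟ left M i ⌋ + 𝟙 ⌊ w ≟ right M i ⌋)
  𝟙-covers M w with covers M w in c
  ... | true with covered⇒endpoint (edgeFamily M) {w} c
  ...   | i , e = sym (trans (∑-supported _ i (λ j j≢i → 𝟙-non-endpoint M {j} {w} (λ e′ → j≢i (disjoint M e′ e))))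
                             (𝟙-endpoint M e))
  𝟙-covers M w | false =
    sym (∑-zero _ λ i → 𝟙-non-endpoint M {i} {w} λ e →
           contradiction (trans (sym (endpoint⇒covered (edgeFamily M) e)) c) λ ())

  count-covers-∧ : ∀ {m} (M : Matching m) (P : Fin N → Bool) →
                   count (λ w → covers M w ∧ P w) ≡ ∑[ i < m ] (𝟙 (P (left M i)) + 𝟙 (P (right M i)))
  count-covers-∧ {m} M P = begin
    ∑[ w < N ] 𝟙 (covers M w ∧ P w)
      ≡⟨ sum-cong-≗ (λ w → trans (𝟙-∧ (covers M w) (P w)) (cong (_* 𝟙 (P w)) (𝟙-covers M w))) ⟩
    ∑[ w < N ] (∑[ i < m ] ends i w * 𝟙 (P w))
      ≡⟨ sum-cong-≗ (λ w → *-distribʳ-sum (𝟙 (P w)) (λ i → ends i w)) ⟩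
    ∑[ w < N ] ∑[ i < m ] (ends i w * 𝟙 (P w))
      ≡⟨ ∑-comm (λ w i → ends i w * 𝟙 (P w)) ⟩
    ∑[ i < m ] ∑[ w < N ] (ends i w * 𝟙 (P w))
      ≡⟨ sum-cong-≗ (λ i → trans (sum-cong-≗ (λ w → *-distribʳ-+ (𝟙 (P w)) (𝟙 ⌊ w ≟ left M i ⌋) _))
                                  (trans (∑-distrib-+ (λ w → 𝟙 ⌊ w ≟ left M i ⌋ * 𝟙 (P w)) _)
                                         (cong₂ _+_ (∑-δ (𝟙 ∘ P) (left M i)) (∑-δ (𝟙 ∘ P) (right M i))))) ⟩
    ∑[ i < m ] (𝟙 (P (left M i)) + 𝟙 (P (right M i)))
      ∎
    where
    open ≡-Reasoning
    ends : Fin m → Fin N → ℕ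
    ends i w = 𝟙 ⌊ w ≟ left M i ⌋ + 𝟙 ⌊ w ≟ right M i ⌋

  count-covers : ∀ {m} (M : Matching m) → count (covers M) ≡ 2 * m
  count-covers {m} M = begin
    count (covers M)                     ≡⟨ sum-cong-≗ (λ w → cong 𝟙 (∧-identityʳ (covers M w))) ⟨
    count (λ w → covers M w ∧ true)      ≡⟨ count-covers-∧ M (λ _ → true) ⟩
    ∑[ i < m ] 2                         ≡⟨ ∑-const m 2 ⟩
    m * 2                                ≡⟨ *-comm m 2 ⟩
    2 * m                                ∎
    where open ≡-Reasoning

  count-covers-∧-≥ : ∀ {m} (M : Matching m) (P : Fin N → Bool) →
                     (∀ i → P (left M i) ∨ P (right M i) ≡ true) → m ≤ count (λ w → covers M w ∧ P w)
  count-covers-∧-≥ {m} M P hit = begin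
    m                                                   ≡⟨ *-identityʳ m ⟨
    m * 1                                               ≡⟨ ∑-const m 1 ⟨
    ∑[ i < m ] 1                                        ≤⟨ ∑-mono-≤ (λ i → 𝟙-∨ (P (left M i)) (P (right M i)) (hit i)) ⟩
    ∑[ i < m ] (𝟙 (P (left M i)) + 𝟙 (P (right M i)))   ≡⟨ count-covers-∧ M P ⟨
    count (λ w → covers M w ∧ P w)                      ∎
    where
    open ≤-Reasoning
    𝟙-∨ : ∀ a b → a ∨ b ≡ true → 1 ≤ 𝟙 a + 𝟙 b
    𝟙-∨ true  _    _ = s≤s z≤n
    𝟙-∨ false true _ = s≤s z≤n

  extend : ∀ {m} (M : Matching m) {x y} → adj H x y ≡ true →
           covers M x ≡ false → covers M y ≡ false → Matching (suc m)
  extend M {x} {y} xy x∉ y∉ = record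
    { left     = x Vector.∷ left M
    ; right    = y Vector.∷ right M
    ; edge     = λ { fzero → xy ; (fsuc i) → edge M i }
    ; disjoint = joint
    }
    where
    uncovered : ∀ {w} → w ≡ x ⊎ w ≡ y → covers M w ≡ false
    uncovered (inj₁ refl) = x∉
    uncovered (inj₂ refl) = y∉
    old : ∀ {i w} → Endpoint (edgeFamily M) i w → ¬ (w ≡ x ⊎ w ≡ y)
    old e new = contradiction (trans (sym (endpoint⇒covered (edgeFamily M) e)) (uncovered new)) λ ()
    joint : ∀ {i j w} → w ≡ (x Vector.∷ left M) i ⊎ w ≡ (y Vector.∷ right M) i →
                        w ≡ (x Vector.∷ left M) j ⊎ w ≡ (y Vector.∷ right M) j → i ≡ j
    joint {fzero}  {fzero}  _ _ = refl
    joint {fzero}  {fsuc j} e e′ = contradiction e (old e′)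
    joint {fsuc i} {fzero}  e e′ = contradiction e′ (old e)
    joint {fsuc i} {fsuc j} e e′ = cong fsuc (disjoint M e e′)

  IsStar-mono : ∀ {k k′} → k ≤ k′ → IsStar k H → IsStar k′ H
  IsStar-mono k≤k′ (A , ∣A∣≤k , independent) = A , ≤-trans ∣A∣≤k k≤k′ , independent

  maximal⇒star : ∀ {m} (M : Matching m) →
                 (∀ u v → covers M u ≡ false → covers M v ≡ false → adj H u v ≡ false) → IsStar (2 * m) H
  maximal⇒star M maximal =
    tabulate (covers M) , ≤-reflexive (trans (∣tabulate∣≡count (covers M)) (count-covers M)) ,
    λ u v u∉ v∉ → maximal u v (∉-tabulate u∉) (∉-tabulate v∉)

  uncoveredEdge? : ∀ {m} (M : Matching m) →
                   Dec (∃ λ x → ∃ λ y → adj H x y ≡ true × covers M x ≡ false × covers M y ≡ false)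
  uncoveredEdge? M = any? λ x → any? λ y → (adj H x y ≟ᵇ true) ×-dec (covers M x ≟ᵇ false) ×-dec (covers M y ≟ᵇ false)

  greedy : ∀ m → Matching m ⊎ IsStar (2 * m) H
  greedy zero = inj₁ (record { left = λ () ; right = λ () ; edge = λ () ; disjoint = λ { {()} } })
  greedy (suc m) with greedy m
  ... | inj₂ star = inj₂ (IsStar-mono (*-monoʳ-≤ 2 (n≤1+n m)) star)
  ... | inj₁ M with uncoveredEdge? M
  ...   | yes (x , y , xy , x∉ , y∉) = inj₁ (extend M xy x∉ y∉)
  ...   | no none = inj₂ (IsStar-mono (*-monoʳ-≤ 2 (n≤1+n m)) (maximal⇒star M independent))
    where
    independent : ∀ u v → covers M u ≡ false → covers M v ≡ false → adj H u v ≡ false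
    independent u v u∉ v∉ = ¬-not λ uv → none (u , v , uv , u∉ , v∉)

  Avoids : ∀ {m} → Matching m → Fin N → Fin m → Set
  Avoids M v i = adj H v (left M i) ≡ false × adj H v (right M i) ≡ false

  avoids? : ∀ {m} (M : Matching m) v i → Dec (Avoids M v i)
  avoids? M v i = (adj H v (left M i) ≟ᵇ false) ×-dec (adj H v (right M i) ≟ᵇ false)

  assign : ∀ {m} → Matching m → Fin N → Fin (suc m)
  assign M v with any? (avoids? M v)
  ... | yes (i , _) = fsuc i
  ... | no _        = fzero

  assign-suc : ∀ {m} (M : Matching m) v {i} → assign M v ≡ fsuc i → Avoids M v i
  assign-suc M v with any? (avoids? M v)
  ... | yes (j , avoids) = λ j≡i → subst (Avoids M v) (fsuc-injective j≡i) avoids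
  ... | no _             = λ ()

  assign-zero : ∀ {m} (M : Matching m) v → isZero (assign M v) ≡ true →
                ∀ i → adj H v (left M i) ∨ adj H v (right M i) ≡ true
  assign-zero M v with any? (avoids? M v)
  ... | yes _    = λ ()
  ... | no none  = λ _ i → hits (adj H v (left M i)) (adj H v (right M i)) (none ∘ (i ,_))
    where
    hits : ∀ a b → ¬ (a ≡ false × b ≡ false) → a ∨ b ≡ true
    hits true  _     _      = refl
    hits false true  _      = refl
    hits false false misses = contradiction (refl , refl) misses

  matching⇒goodPartition : ∀ {d} .{{_ : NonZero d}} → DegeneracyAtMost d H → Matching (2 * d) →
                           GoodPartition (4 * d) (2 * d) H
  matching⇒goodPartition {d} deg M = edgeFamily M , assign M , (λ _ v _ → assign-suc M v) , A₀-bound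
    where
    A₀ : Fin N → Bool
    A₀ v = not (covers M v) ∧ isZero (assign M v)
    A₀-uncovered : ∀ v → A₀ v ≡ true → covers M v ≡ false
    A₀-uncovered v A₀v with covers M v | A₀v
    ... | false | _ = refl
    A₀-dominated : ∀ b → A₀ b ≡ true → 2 * d ≤ count (λ w → covers M w ∧ adj H b w)
    A₀-dominated b A₀b = count-covers-∧-≥ M (adj H b) (assign-zero M b (∧-conicalʳ _ _ A₀b))
    A₀-bound : ∣ tabulate A₀ ∣ ≤ 4 * d
    A₀-bound rewrite ∣tabulate∣≡count A₀ = 2dx≤d[x+c]⇒x≤c d (begin
      2 * d * count A₀                          ≤⟨ crossing-≤ deg A₀ (covers M) A₀-uncovered A₀-dominated ⟩
      d * (count A₀ + count (covers M))         ≡⟨ cong (λ c → d * (count A₀ + c)) (count-covers M) ⟩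
      d * (count A₀ + 2 * (2 * d))              ≡⟨ cong (λ c → d * (count A₀ + c)) (*-assoc 2 2 d) ⟨
      d * (count A₀ + 4 * d)                    ∎)
      where open ≤-Reasoning

lemma21 : (d : ℕ) (H : Graph) → DegeneracyAtMost d H →
    IsStar (4 * d) H ⊎ GoodPartition (4 * d) (2 * d) H
lemma21 zero H deg = inj₁ (∅ , ≤-reflexive (∣⊥∣≡0 (n H)) , λ u v _ _ → edgeless H deg u v)
lemma21 d@(suc _) H deg with greedy H (2 * d)
... | inj₁ M    = inj₂ (matching⇒goodPartition H deg M)
... | inj₂ star = inj₁ (IsStar-mono H (≤-reflexive (sym (*-assoc 2 2 d))) star)
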